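{- Let $(\mathsf P,\mathcal O)$ be a semitopology, let $\mathsf{Val}$ be a nonempty set equipped with the discrete semitopology $\mathcal P(\mathsf{Val})$, and let $f:\mathsf P\to\mathsf{Val}$ be any function. Let $T\subseteq\mathsf P$ be a transitive set and let $p,p'\in T$. Then: (1) if $f$ is continuous at $p$ and at $p'$, then $f(p)=f(p')$; (2) consequently, if $f$ is continuous at every point of $T$, then $f$ is constant on $T$.
   Context: A semitopology $(\mathsf P,\mathcal O)$ consists of a set $\mathsf P$ of points and a family $\mathcal O\subseteq\mathcal P(\mathsf P)$ of open sets such that $\varnothing,\mathsf P\in\mathcal O$ and $\mathcal O$ is closed under arbitrary unions; intersections of open sets need not be open. For sets $X,Y$ write $X\between Y$ when $X\cap Y\neq\varnothing$. A set $T\subseteq\mathsf P$ is transitive when for all $O,O'\in\mathcal O$, if $O\between T$ and $T\between O'$ then $O\between O'$. A function $f:\mathsf P\to\mathsf P'$ between semitopologies is continuous at $p$ when for every open $O'\ni f(p)$ there is an open $O\ni p$ with $O\subseteq f^{ -1}(O')$. -}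

module Defs where

open import Level using (Level; suc; _⊔_) renaming (zero to lzero)
open import Data.Product using (Σ; ∃; ∃-syntax; _×_; _,_)
open import Data.Empty using (⊥)
open import Data.Unit using (⊤)
open import Relation.Binary.PropositionalEquality using (_≡_)

Subset : Set → Set₁
Subset A = A → Set

_∈_ : {A : Set} → A → Subset A → Set
x ∈ X = X x

_⊆_ : {A : Set} → Subset A → Subset A → Set
X ⊆ Y = ∀ {x} → x ∈ X → x ∈ Y

∅ : {A : Set} → Subset A
∅ _ = ⊥

Full : {A : Set} → Subset A
Full _ = ⊤

_≬_ : {A : Set} → Subset A → Subset A → Set
X ≬ Y = ∃[ x ] (x ∈ X × x ∈ Y)

⋃ : {A I : Set} → (I → Subset A) → Subset A
⋃ {I = I} U x = ∃[ i ] (x ∈ U i)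

_⁻¹[_] : {A B : Set} → (A → B) → Subset B → Subset A
(f ⁻¹[ Y ]) x = f x ∈ Y

record Semitopology : Set₂ where
  field
    Pt      : Set
    IsOpen  : Subset Pt → Set₁
    open-∅    : IsOpen ∅
    open-Full : IsOpen Full
    open-⋃    : {I : Set} (U : I → Subset Pt) → (∀ i → IsOpen (U i)) → IsOpen (⋃ U)

open Semitopology public

Discrete : Set → Semitopology
Discrete V = record
  { Pt = V
  ; IsOpen = λ _ → Lift⊤
  ; open-∅ = lift-tt
  ; open-Full = lift-tt
  ; open-⋃ = λ _ _ → lift-tt
  }
  where
    open import Level using (Lift; lift)
    Lift⊤ : Set₁
    Lift⊤ = Lift (suc lzero) ⊤
    lift-tt : Lift⊤
    lift-tt = lift _

Transitive : (S : Semitopology) → Subset (Pt S) → Set₁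
Transitive S T = ∀ (O O' : Subset (Pt S)) → IsOpen S O → IsOpen S O' →
  O ≬ T → T ≬ O' → O ≬ O'

ContinuousAt : (S S' : Semitopology) → (Pt S → Pt S') → Pt S → Set₁
ContinuousAt S S' f p = ∀ (O' : Subset (Pt S')) → IsOpen S' O' → f p ∈ O' →
  Σ (Subset (Pt S)) λ O → IsOpen S O × p ∈ O × O ⊆ (f ⁻¹[ O' ])

-- In the discrete semitopology the singleton {f p} is open, so continuity at p
-- yields an open neighbourhood of p on which f is constantly f p. For p, p' ∈ T
-- these two neighbourhoods both meet T, so by transitivity they meet each other,
-- and at a common point x we get f p ≡ f x ≡ f p'.
module Submission where

open import Defs
open import Data.Product using (Σ; _×_; _,_)
open import Relation.Binary.PropositionalEquality using (_≡_; refl; sym; trans)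
open import Level using (lift)

module _ (S : Semitopology) {Val : Set} (f : Pt S → Val) where

  fiber : Val → Subset Val
  fiber v w = w ≡ v

  continuousAt⇒locallyConstant : ∀ {p} → ContinuousAt S (Discrete Val) f p →
    Σ (Subset (Pt S)) λ O → IsOpen S O × p ∈ O × O ⊆ (f ⁻¹[ fiber (f p) ])
  continuousAt⇒locallyConstant cont = cont (fiber (f _)) (lift _) refl

  transitive⇒continuousAt-≡ : ∀ {T} → Transitive S T → ∀ {p p'} → p ∈ T → p' ∈ T →
    ContinuousAt S (Discrete Val) f p → ContinuousAt S (Discrete Val) f p' → f p ≡ f p'
  transitive⇒continuousAt-≡ tr {p} {p'} p∈T p'∈T cont cont'
    with continuousAt⇒locallyConstant cont | continuousAt⇒locallyConstant cont'
  ... | O , O-open , p∈O , O⊆ | O' , O'-open , p'∈O' , O'⊆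
    with tr O O' O-open O'-open (p , p∈O , p∈T) (p' , p'∈T , p'∈O')
  ... | x , x∈O , x∈O' = trans (sym (O⊆ x∈O)) (O'⊆ x∈O')

theorem3p5 : (S : Semitopology) (Val : Set) → (v₀ : Val) →
    (f : Pt S → Val) (T : Subset (Pt S)) → Transitive S T →
    ((p p' : Pt S) → p ∈ T → p' ∈ T →
      ContinuousAt S (Discrete Val) f p → ContinuousAt S (Discrete Val) f p' → f p ≡ f p')
    × ((∀ q → q ∈ T → ContinuousAt S (Discrete Val) f q) →
      (p p' : Pt S) → p ∈ T → p' ∈ T → f p ≡ f p')
theorem3p5 S Val _ f T tr =
    (λ p p' → pairwise)
  , λ cont p p' p∈T p'∈T → pairwise p∈T p'∈T (cont p p∈T) (cont p' p'∈T)
  where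
  pairwise : ∀ {p p'} → p ∈ T → p' ∈ T →
    ContinuousAt S (Discrete Val) f p → ContinuousAt S (Discrete Val) f p' → f p ≡ f p'
  pairwise = transitive⇒continuousAt-≡ S f tr
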